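{- For every integer $\ell\geq 1$, every finite digraph $G$ with $\delta^+(G)\geq (1+\sqrt{5})\ell$ contains $S^-_{2,\ell}$ as a subgraph.
   Context: All digraphs are finite, without loops or multiple copies of the same edge (two oppositely oriented edges between a pair of vertices are allowed). $\delta^+(G)$ is the minimum out-degree of $G$. $S^-_{k,\ell}$ denotes the $(k-1)$-subdivision of the in-star with $\ell$ leaves: it consists of a centre vertex and $\ell$ directed paths of length $k$ ending at the centre, pairwise disjoint apart from the centre. In particular $S^-_{2,\ell}$ consists of a centre $c$ and distinct vertices $a_1,\dots,a_\ell,x_1,\dots,x_\ell$ with edges $(x_i,a_i)$ and $(a_i,c)$ for all $i$. -}

module Defs where

open import Data.Nat using (ℕ; _≤_; _*_; _∸_; _<_)
open import Data.Fin using (Fin)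
open import Data.Fin.Subset using (Subset; ∣_∣)
open import Data.Vec using (tabulate)
open import Data.Bool using (Bool; true; false)
open import Data.Product using (Σ; ∃; ∃-syntax; _×_)
open import Relation.Binary.PropositionalEquality using (_≡_; _≢_)

-- Two opposite edges between a pair of vertices are allowed; multiple
-- copies of the same edge are impossible by construction.
record Digraph : Set where
  field
    n        : ℕ
    adj      : Fin n → Fin n → Bool
    loopless : ∀ v → adj v v ≡ false

open Digraph public

Edge : (G : Digraph) → Fin (n G) → Fin (n G) → Set
Edge G u v = adj G u v ≡ true

outNbhd : (G : Digraph) → Fin (n G) → Subset (n G)
outNbhd G u = tabulate (adj G u)

outdeg : (G : Digraph) → Fin (n G) → ℕ
outdeg G u = ∣ outNbhd G u ∣

-- For a natural number d and ℓ : ℕ,  d ≥ (1 + √5) ℓ  ⇔  d ≥ ℓ ∧ (d − ℓ)² ≥ 5 ℓ².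
-- (exact, since d − ℓ ≥ √5 ℓ ≥ 0 iff d ≥ ℓ and (d − ℓ)² ≥ 5ℓ²)
AtLeastOnePlusSqrt5Times : ℕ → ℕ → Set
AtLeastOnePlusSqrt5Times ℓ d = ℓ ≤ d × 5 * (ℓ * ℓ) ≤ (d ∸ ℓ) * (d ∸ ℓ)

-- δ⁺(G) ≥ (1 + √5) ℓ, for a nonempty digraph G (minimum out-degree is
-- only defined for nonempty digraphs).
MinOutdegAtLeast1+√5Times : Digraph → ℕ → Set
MinOutdegAtLeast1+√5Times G ℓ =
  0 < n G × (∀ v → AtLeastOnePlusSqrt5Times ℓ (outdeg G v))

ContainsS⁻₂ : Digraph → ℕ → Set
ContainsS⁻₂ G ℓ =
  Σ (Fin (n G)) λ c →
  Σ (Fin ℓ → Fin (n G)) λ a →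
  Σ (Fin ℓ → Fin (n G)) λ x →
    (∀ i j → a i ≡ a j → i ≡ j) ×
    (∀ i j → x i ≡ x j → i ≡ j) ×
    (∀ i j → a i ≢ x j) ×
    (∀ i → a i ≢ c) ×
    (∀ i → x i ≢ c) ×
    (∀ i → Edge G (x i) (a i)) ×
    (∀ i → Edge G (a i) c)

-- Let d = δ⁺(G) and pass to a spanning subgraph in which every out-degree is exactly d.  Weigh each
-- vertex a by w(a) = min(d⁻(a), d) and give each vertex c the load Σ_{a → c} w(a).  Double counting
-- gives Σ_c load(c) = d · Σ_a w(a), which forces a centre c with load(c) ≥ d²: otherwise
-- load(c) ≤ d · w(c) everywhere, strictly where d⁻(c) ≥ d, and if there is no such c then Σ d⁻ < n d.
-- Call an in-neighbour of c heavy if its in-degree is at least 2ℓ, and greedily add paths x → a → c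
-- through new vertices with a light and x not heavy.  If this stops with k paths while k + h < ℓ
-- (h heavy in-neighbours), all in-neighbours of an unused light a are among the at most 2k + h + 1
-- used, heavy or central vertices, so load(c) ≤ d h + (2ℓ − 1) 2k + (2k + h + 1) d < 2ℓd + 4ℓ² ≤ d²,
-- the last step being d ≥ (1 + √5) ℓ.  So k + h ≥ ℓ, and the missing ℓ − k paths run through heavy
-- in-neighbours: each has at least 2ℓ in-neighbours, more than the vertices used or reserved so far.

module Submission where

open import Data.Bool using (Bool; true; false; _∧_; _∨_; if_then_else_)
open import Data.Bool.Properties using (∧-conicalˡ; ∧-conicalʳ; ∨-conicalˡ; ∨-conicalʳ; ¬-not)
import Data.Bool.Properties as Bool using (_≟_)
open import Data.Sum using (_⊎_; inj₁; inj₂)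
open import Data.Fin using (Fin; zero; suc; fromℕ<)
open import Data.Fin.Properties using (_≟_; any?; suc-injective; 0≢1+n)
open import Data.Fin.Subset using (∣_∣)
open import Data.List using (allFin)
open import Data.List.Extrema.Nat using (argmin; f[argmin]≤f[xs])
open import Data.List.Membership.Propositional.Properties using (∈-allFin)
import Data.List.Relation.Unary.All as All
open import Data.Nat using (ℕ; zero; suc; _+_; _*_; _∸_; _⊓_; _≤_; _<_; z≤n; s≤s; _≤?_)
open import Data.Nat.Properties hiding (_≟_; suc-injective; 0≢1+n)
open import Data.Nat.Tactic.RingSolver using (solve-∀)
open import Data.Product using (Σ; ∃; _×_; _,_; proj₁; proj₂)
import Data.Product as Product
open import Data.Vec using (tabulate)
open import Data.Vec.Functional using (_∷_)
open import Function using (_∘_; id; Injective)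
open import Relation.Binary.PropositionalEquality
open import Relation.Nullary using (Dec; yes; no; does; ¬_; contradiction)
open import Relation.Nullary.Decidable using (dec-false; _×-dec_)

open import Algebra.Properties.Semiring.Sum +-*-semiring
  using (sum; sum-syntax; sum-cong-≗; sum-replicate-zero; ∑-comm; ∑-distrib-+; *-distribˡ-sum; *-distribʳ-sum)

open import Defs

⟦_⟧ : Bool → ℕ
⟦ true ⟧ = 1
⟦ false ⟧ = 0

⟦⟧*≤ : ∀ b {x y} → (b ≡ true → x ≤ y) → ⟦ b ⟧ * x ≤ y
⟦⟧*≤ false _   = z≤n
⟦⟧*≤ true  x≤y = ≤-trans (≤-reflexive (*-identityˡ _)) (x≤y refl)

count : ∀ {n} → (Fin n → Bool) → ℕ
count {n} p = ∑[ i < n ] ⟦ p i ⟧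

sum-mono-≤ : ∀ {n} {f g : Fin n → ℕ} → (∀ i → f i ≤ g i) → sum f ≤ sum g
sum-mono-≤ {zero} f≤g = z≤n
sum-mono-≤ {suc n} f≤g = +-mono-≤ (f≤g zero) (sum-mono-≤ (f≤g ∘ suc))

sum-mono-< : ∀ {n} {f g : Fin n → ℕ} → (∀ i → f i ≤ g i) → ∀ j → f j < g j → sum f < sum g
sum-mono-< f≤g zero fj<gj = +-mono-<-≤ fj<gj (sum-mono-≤ (f≤g ∘ suc))
sum-mono-< f≤g (suc j) fj<gj = +-mono-≤-< (f≤g zero) (sum-mono-< (f≤g ∘ suc) j fj<gj)

count-∨ : ∀ {n} (p q : Fin n → Bool) → count (λ i → p i ∨ q i) ≤ count p + count q
count-∨ p q =
  ≤-trans (sum-mono-≤ (λ i → ⟦∨⟧≤ (p i) (q i))) (≤-reflexive (∑-distrib-+ (⟦_⟧ ∘ p) (⟦_⟧ ∘ q)))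
  where
  ⟦∨⟧≤ : ∀ a b → ⟦ a ∨ b ⟧ ≤ ⟦ a ⟧ + ⟦ b ⟧
  ⟦∨⟧≤ true b = s≤s z≤n
  ⟦∨⟧≤ false b = ≤-refl

count-≟ : ∀ {n} (u : Fin n) → count (λ v → does (u ≟ v)) ≡ 1
count-≟ {suc n} zero = cong suc (sum-replicate-zero n)
count-≟ (suc u) = count-≟ u

count-pigeonhole : ∀ {n} (p q : Fin n → Bool) → count q < count p →
                   ∃ λ v → p v ≡ true × q v ≡ false
count-pigeonhole {suc n} p q q<p with p zero in p₀ | q zero in q₀
... | true  | false = zero , p₀ , q₀
... | true  | true  = Product.map suc id (count-pigeonhole (p ∘ suc) (q ∘ suc) (≤-pred q<p))
... | false | false = Product.map suc id (count-pigeonhole (p ∘ suc) (q ∘ suc) q<p)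
... | false | true  = Product.map suc id (count-pigeonhole (p ∘ suc) (q ∘ suc) (<⇒≤ q<p))

does≡true⇒ : ∀ {a} {A : Set a} (a? : Dec A) → does a? ≡ true → A
does≡true⇒ (yes a) _ = a

does≡false⇒¬ : ∀ {a} {A : Set a} (a? : Dec A) → does a? ≡ false → ¬ A
does≡false⇒¬ (no ¬a) _ = ¬a

image? : ∀ {k n} → (Fin k → Fin n) → Fin n → Bool
image? f v = does (any? λ i → f i ≟ v)

image?-false⁻ : ∀ {k n} {f : Fin k → Fin n} {v} → image? f v ≡ false → ∀ i → f i ≢ v
image?-false⁻ v∉f i fi≡v = does≡false⇒¬ (any? _) v∉f (i , fi≡v)

count-image? : ∀ {k n} (f : Fin k → Fin n) → count (image? f) ≤ k
count-image? {zero} {n} f = ≤-reflexive (sum-replicate-zero n)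
count-image? {suc k} f = begin
  count (image? f)
    ≤⟨ count-∨ (λ v → does (f zero ≟ v)) (image? (f ∘ suc)) ⟩
  count (λ v → does (f zero ≟ v)) + count (image? (f ∘ suc))
    ≤⟨ +-mono-≤ (≤-reflexive (count-≟ (f zero))) (count-image? (f ∘ suc)) ⟩
  suc k
    ∎
  where open ≤-Reasoning

injective-∷ : ∀ {k n} {f : Fin k → Fin n} {v} →
              Injective _≡_ _≡_ f → (∀ i → f i ≢ v) → Injective _≡_ _≡_ (v ∷ f)
injective-∷ f-inj v∉f {zero}  {zero}  _ = refl
injective-∷ f-inj v∉f {zero}  {suc j} v≡fj = contradiction (sym v≡fj) (v∉f j)
injective-∷ f-inj v∉f {suc i} {zero}  fi≡v = contradiction fi≡v (v∉f i)
injective-∷ f-inj v∉f {suc i} {suc j} fi≡fj = cong suc (f-inj fi≡fj)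

select : ∀ {n} (p : Fin n → Bool) m → m ≤ count p →
         Σ (Fin m → Fin n) λ f → Injective _≡_ _≡_ f × (∀ i → p (f i) ≡ true)
select p zero _ = (λ ()) , (λ {}) , (λ ())
select p (suc m) m<count with select p m (<⇒≤ m<count)
... | f , f-inj , pf with count-pigeonhole p (image? f) (≤-<-trans (count-image? f) m<count)
...   | v , pv , v∉f = v ∷ f , injective-∷ f-inj (image?-false⁻ v∉f) , λ { zero → pv ; (suc i) → pf i }

∣tabulate∣≡count : ∀ {n} (p : Fin n → Bool) → ∣ tabulate p ∣ ≡ count p
∣tabulate∣≡count {zero} p = refl
∣tabulate∣≡count {suc n} p with p zero
... | true  = cong suc (∣tabulate∣≡count (p ∘ suc))
... | false = ∣tabulate∣≡count (p ∘ suc)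

keepFirst : ∀ {n} → ℕ → (Fin n → Bool) → Fin n → Bool
keepFirst {suc n} zero    p i       = false
keepFirst {suc n} (suc d) p zero    = p zero
keepFirst {suc n} (suc d) p (suc i) = keepFirst (if p zero then d else suc d) (p ∘ suc) i

keepFirst-⊆ : ∀ {n} d (p : Fin n → Bool) {i} → keepFirst d p i ≡ true → p i ≡ true
keepFirst-⊆ {suc n} (suc d) p {zero}  kept = kept
keepFirst-⊆ {suc n} (suc d) p {suc i} kept = keepFirst-⊆ _ (p ∘ suc) kept

count-keepFirst : ∀ {n} d (p : Fin n → Bool) → d ≤ count p → count (keepFirst d p) ≡ d
count-keepFirst {zero}  zero    p _ = refl
count-keepFirst {suc n} zero    p _ = sum-replicate-zero (suc n)
count-keepFirst {suc n} (suc d) p d<count with p zero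
... | true  = cong suc (count-keepFirst d (p ∘ suc) (≤-pred d<count))
... | false = count-keepFirst (suc d) (p ∘ suc) d<count

prune : Digraph → ℕ → Digraph
prune G d = record
  { n        = n G
  ; adj      = λ u → keepFirst d (adj G u)
  ; loopless = λ v → ¬-not λ kept →
                 contradiction (trans (sym (loopless G v)) (keepFirst-⊆ d (adj G v) kept)) λ ()
  }

outdeg-prune : ∀ G {d} u → d ≤ outdeg G u → outdeg (prune G d) u ≡ d
outdeg-prune G {d} u d≤outdeg = begin
  outdeg (prune G d) u          ≡⟨ ∣tabulate∣≡count (keepFirst d (adj G u)) ⟩
  count (keepFirst d (adj G u)) ≡⟨ count-keepFirst d (adj G u) d≤count ⟩
  d                             ∎
  where
  open ≡-Reasoning
  d≤count : d ≤ count (adj G u)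
  d≤count = subst (d ≤_) (∣tabulate∣≡count (adj G u)) d≤outdeg

ContainsS⁻₂-prune : ∀ G d {ℓ} → ContainsS⁻₂ (prune G d) ℓ → ContainsS⁻₂ G ℓ
ContainsS⁻₂-prune G d (c , a , x , a-inj , x-inj , a≢x , a≢c , x≢c , x→a , a→c) =
  c , a , x , a-inj , x-inj , a≢x , a≢c , x≢c ,
  (λ i → keepFirst-⊆ d (adj G (x i)) (x→a i)) , (λ i → keepFirst-⊆ d (adj G (a i)) (a→c i))

minOutdegVertex : (G : Digraph) → Fin (n G) → Fin (n G)
minOutdegVertex G v = argmin (outdeg G) v (allFin (n G))

minOutdegVertex-≤ : ∀ G v u → outdeg G (minOutdegVertex G v) ≤ outdeg G u
minOutdegVertex-≤ G v u = All.lookup (f[argmin]≤f[xs] v (allFin (n G))) (∈-allFin u)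

edge⇒≢ : ∀ {G u v} → Edge G u v → u ≢ v
edge⇒≢ {G} {u} u→u refl = contradiction (trans (sym (loopless G u)) u→u) λ ()

record Star⁻₂ (G : Digraph) (c : Fin (n G)) (k : ℕ) : Set where
  field
    mid leaf       : Fin k → Fin (n G)
    mid-injective  : Injective _≡_ _≡_ mid
    leaf-injective : Injective _≡_ _≡_ leaf
    mid≢leaf       : ∀ i j → mid i ≢ leaf j
    mid≢c          : ∀ i → mid i ≢ c
    leaf≢c         : ∀ i → leaf i ≢ c
    leaf→mid       : ∀ i → Edge G (leaf i) (mid i)
    mid→c          : ∀ i → Edge G (mid i) c

open Star⁻₂

Star⁻₂⇒ContainsS⁻₂ : ∀ {G c ℓ} → Star⁻₂ G c ℓ → ContainsS⁻₂ G ℓ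
Star⁻₂⇒ContainsS⁻₂ {c = c} P =
  c , mid P , leaf P , (λ _ _ → mid-injective P) , (λ _ _ → leaf-injective P) ,
  mid≢leaf P , mid≢c P , leaf≢c P , leaf→mid P , mid→c P

emptyStar : ∀ {G c} → Star⁻₂ G c 0
emptyStar = record
  { mid = λ () ; leaf = λ () ; mid-injective = λ {} ; leaf-injective = λ {}
  ; mid≢leaf = λ () ; mid≢c = λ () ; leaf≢c = λ () ; leaf→mid = λ () ; mid→c = λ () }

module _ {G c k} (P : Star⁻₂ G c k) where

  used : Fin (n G) → Bool
  used v = image? (mid P) v ∨ image? (leaf P) v

  count-used : count used ≤ k + k
  count-used = ≤-trans (count-∨ (image? (mid P)) (image? (leaf P)))
                       (+-mono-≤ (count-image? (mid P)) (count-image? (leaf P)))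

  unused⇒∉mid : ∀ {v} → used v ≡ false → ∀ i → mid P i ≢ v
  unused⇒∉mid {v} unused = image?-false⁻ (∨-conicalˡ (image? (mid P) v) _ unused)

  unused⇒∉leaf : ∀ {v} → used v ≡ false → ∀ i → leaf P i ≢ v
  unused⇒∉leaf {v} unused = image?-false⁻ (∨-conicalʳ (image? (mid P) v) _ unused)

  extend : ∀ {x a} → Edge G x a → Edge G a c → used x ≡ false → used a ≡ false → x ≢ c →
           Star⁻₂ G c (suc k)
  extend {x} {a} x→a a→c x-unused a-unused x≢c = record
    { mid            = a ∷ mid P
    ; leaf           = x ∷ leaf P
    ; mid-injective  = injective-∷ (mid-injective P) (unused⇒∉mid a-unused)
    ; leaf-injective = injective-∷ (leaf-injective P) (unused⇒∉leaf x-unused)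
    ; mid≢leaf       = λ { zero zero → edge⇒≢ {G} x→a ∘ sym
                         ; zero (suc j) → unused⇒∉leaf a-unused j ∘ sym
                         ; (suc i) zero → unused⇒∉mid x-unused i
                         ; (suc i) (suc j) → mid≢leaf P i j }
    ; mid≢c          = λ { zero → edge⇒≢ {G} a→c ; (suc i) → mid≢c P i }
    ; leaf≢c         = λ { zero → x≢c ; (suc i) → leaf≢c P i }
    ; leaf→mid       = λ { zero → x→a ; (suc i) → leaf→mid P i }
    ; mid→c          = λ { zero → a→c ; (suc i) → mid→c P i }
    }

used-extend : ∀ {G c k x a v} (P : Star⁻₂ G c k) (x→a : Edge G x a) (a→c : Edge G a c)
              x-unused a-unused (x≢c : x ≢ c) → used P v ≡ false → a ≢ v → x ≢ v →
              used (extend P x→a a→c x-unused a-unused x≢c) v ≡ false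
used-extend {x = x} {a} {v} P _ _ _ _ _ v-unused a≢v x≢v
  rewrite dec-false (a ≟ v) a≢v | dec-false (x ≟ v) x≢v = v-unused

d≥[1+√5]ℓ⇒2ℓd+4ℓ²≤d² : ∀ {ℓ d} → AtLeastOnePlusSqrt5Times ℓ d →
                        2 * ℓ * d + 4 * (ℓ * ℓ) ≤ d * d
d≥[1+√5]ℓ⇒2ℓd+4ℓ²≤d² {ℓ} {d} (ℓ≤d , 5ℓ²≤e²) =
  subst (λ d → 2 * ℓ * d + 4 * (ℓ * ℓ) ≤ d * d) (m∸n+n≡m ℓ≤d) (begin
    2 * ℓ * (e + ℓ) + 4 * (ℓ * ℓ)     ≡⟨ lhs-expand e ℓ ⟩
    5 * (ℓ * ℓ) + (2 * ℓ * e + ℓ * ℓ) ≤⟨ +-monoˡ-≤ _ 5ℓ²≤e² ⟩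
    e * e + (2 * ℓ * e + ℓ * ℓ)       ≡⟨ rhs-expand e ℓ ⟨
    (e + ℓ) * (e + ℓ)                 ∎)
  where
  open ≤-Reasoning
  e : ℕ
  e = d ∸ ℓ
  lhs-expand : ∀ e ℓ → 2 * ℓ * (e + ℓ) + 4 * (ℓ * ℓ) ≡ 5 * (ℓ * ℓ) + (2 * ℓ * e + ℓ * ℓ)
  lhs-expand = solve-∀
  rhs-expand : ∀ e ℓ → (e + ℓ) * (e + ℓ) ≡ e * e + (2 * ℓ * e + ℓ * ℓ)
  rhs-expand = solve-∀

-- Here ℓ = suc m, and m + suc m = 2ℓ − 1 bounds the in-degree of a light vertex.
stuck-load-bound : ∀ {m d k h} → k + h ≤ m → 2 * suc m * d + 4 * (suc m * suc m) ≤ d * d →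
                   d * h + ((m + suc m) * (k + k) + d * ((k + k) + (h + 1))) < d * d
stuck-load-bound {m} {d} {k} {h} k+h≤m d-large = begin-strict
  d * h + ((m + suc m) * (k + k) + d * ((k + k) + (h + 1)))
    ≡⟨ regroup d m k h ⟩
  d * suc ((k + h) + (k + h)) + (m + suc m) * (k + k)
    ≤⟨ +-mono-≤ (*-monoʳ-≤ d (s≤s (+-mono-≤ k+h≤m k+h≤m))) (*-monoʳ-≤ (m + suc m) (+-mono-≤ k≤m k≤m)) ⟩
  d * suc (m + m) + (m + suc m) * (m + m)
    <⟨ m<m+n _ (s≤s z≤n) ⟩
  d * suc (m + m) + (m + suc m) * (m + m) + (4 + 6 * m + d)
    ≡⟨ slack d m ⟩
  2 * suc m * d + 4 * (suc m * suc m)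
    ≤⟨ d-large ⟩
  d * d
    ∎
  where
  open ≤-Reasoning
  k≤m : k ≤ m
  k≤m = ≤-trans (m≤m+n k h) k+h≤m
  regroup : ∀ d m k h → d * h + ((m + suc m) * (k + k) + d * ((k + k) + (h + 1)))
                      ≡ d * suc ((k + h) + (k + h)) + (m + suc m) * (k + k)
  regroup = solve-∀
  slack : ∀ d m → d * suc (m + m) + (m + suc m) * (m + m) + (4 + 6 * m + d)
                ≡ 2 * suc m * d + 4 * (suc m * suc m)
  slack = solve-∀

module OutRegular (G : Digraph) (d : ℕ) (regular : ∀ u → outdeg G u ≡ d) where

  indeg : Fin (n G) → ℕ
  indeg v = count (λ u → adj G u v)

  weight : Fin (n G) → ℕ
  weight v = indeg v ⊓ d

  load : Fin (n G) → ℕ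
  load c = ∑[ a < n G ] (⟦ adj G a c ⟧ * weight a)

  ∑-in-edges : (f : Fin (n G) → ℕ) →
               ∑[ v < n G ] ∑[ u < n G ] (⟦ adj G u v ⟧ * f u) ≡ ∑[ u < n G ] (d * f u)
  ∑-in-edges f = begin
    ∑[ v < n G ] ∑[ u < n G ] (⟦ adj G u v ⟧ * f u)
      ≡⟨ ∑-comm (λ v u → ⟦ adj G u v ⟧ * f u) ⟩
    ∑[ u < n G ] ∑[ v < n G ] (⟦ adj G u v ⟧ * f u)
      ≡⟨ sum-cong-≗ {n G} (λ u → *-distribʳ-sum (f u) (⟦_⟧ ∘ adj G u)) ⟨
    ∑[ u < n G ] (count (adj G u) * f u)
      ≡⟨ sum-cong-≗ {n G} (λ u → cong (_* f u) outdeg≡d) ⟩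
    ∑[ u < n G ] (d * f u)
      ∎
    where
    open ≡-Reasoning
    outdeg≡d : ∀ {u} → count (adj G u) ≡ d
    outdeg≡d {u} = trans (sym (∣tabulate∣≡count (adj G u))) (regular u)

  ∑-indeg : ∑[ v < n G ] indeg v ≡ ∑[ u < n G ] d
  ∑-indeg = begin
    ∑[ v < n G ] indeg v
      ≡⟨ sum-cong-≗ {n G} (λ v → sum-cong-≗ {n G} (λ u → *-identityʳ ⟦ adj G u v ⟧)) ⟨
    ∑[ v < n G ] ∑[ u < n G ] (⟦ adj G u v ⟧ * 1)
      ≡⟨ ∑-in-edges (λ _ → 1) ⟩
    ∑[ u < n G ] (d * 1)
      ≡⟨ sum-cong-≗ {n G} (λ _ → *-identityʳ d) ⟩
    ∑[ u < n G ] d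
      ∎
    where open ≡-Reasoning

  load≤indeg*d : ∀ c → load c ≤ indeg c * d
  load≤indeg*d c = begin
    load c                           ≤⟨ sum-mono-≤ (λ a → *-monoʳ-≤ ⟦ adj G a c ⟧ (m⊓n≤n (indeg a) d)) ⟩
    ∑[ a < n G ] (⟦ adj G a c ⟧ * d) ≡⟨ *-distribʳ-sum d (λ a → ⟦ adj G a c ⟧) ⟨
    indeg c * d                      ∎
    where open ≤-Reasoning

  ¬all-loads<d² : Fin (n G) → ¬ (∀ c → load c < d * d)
  ¬all-loads<d² v load<d² with any? (λ c → d ≤? indeg c)
  ... | yes (c , d≤indeg) = <-irrefl (∑-in-edges weight) (sum-mono-< load≤d*weight c load<d*weight)
    where
    load≤d*weight : ∀ c → load c ≤ d * weight c
    load≤d*weight c with indeg c ≤? d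
    ... | yes indeg≤d = ≤-trans (load≤indeg*d c)
                          (≤-reflexive (trans (*-comm (indeg c) d) (cong (d *_) (sym (m≤n⇒m⊓n≡m indeg≤d)))))
    ... | no indeg≰d  = ≤-trans (<⇒≤ (load<d² c))
                          (≤-reflexive (cong (d *_) (sym (m≥n⇒m⊓n≡n (<⇒≤ (≰⇒> indeg≰d))))))
    load<d*weight : load c < d * weight c
    load<d*weight = ≤-trans (load<d² c) (≤-reflexive (cong (d *_) (sym (m≥n⇒m⊓n≡n d≤indeg))))
  ... | no ∄c = <-irrefl ∑-indeg (sum-mono-< (λ c → <⇒≤ (indeg<d c)) v (indeg<d v))
    where
    indeg<d : ∀ c → indeg c < d
    indeg<d c = ≰⇒> (λ d≤indeg → ∄c (c , d≤indeg))

  ∃-load≥d² : Fin (n G) → ∃ λ c → d * d ≤ load c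
  ∃-load≥d² v with any? (λ c → d * d ≤? load c)
  ... | yes found = found
  ... | no ∄c = contradiction (λ c → ≰⇒> (λ d²≤load → ∄c (c , d²≤load))) (¬all-loads<d² v)

  module Greedy (m : ℕ) (d-large : 2 * suc m * d + 4 * (suc m * suc m) ≤ d * d) (c : Fin (n G)) where

    ℓ : ℕ
    ℓ = suc m

    heavy : Fin (n G) → Bool
    heavy a = adj G a c ∧ does (ℓ + ℓ ≤? indeg a)

    h : ℕ
    h = count heavy

    heavy⇒ : ∀ {a} → heavy a ≡ true → Edge G a c × ℓ + ℓ ≤ indeg a
    heavy⇒ {a} a-heavy =
      ∧-conicalˡ _ _ a-heavy , does≡true⇒ (ℓ + ℓ ≤? indeg a) (∧-conicalʳ (adj G a c) _ a-heavy)

    light-indeg : ∀ {a} → Edge G a c → heavy a ≡ false → indeg a ≤ m + ℓ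
    light-indeg {a} a→c a-light = ≤-pred (≰⇒> (does≡false⇒¬ (ℓ + ℓ ≤? indeg a) small))
      where
      small : does (ℓ + ℓ ≤? indeg a) ≡ false
      small = trans (cong (_∧ does (ℓ + ℓ ≤? indeg a)) (sym a→c)) a-light

    light≢heavy : ∀ {u v} → heavy u ≡ false → heavy v ≡ true → u ≢ v
    light≢heavy u-light v-heavy refl = contradiction (trans (sym u-light) v-heavy) λ ()

    AvoidsHeavy : ∀ {k} → Star⁻₂ G c k → Set
    AvoidsHeavy P = ∀ v → heavy v ≡ true → used P v ≡ false

    blocked : ∀ {k} → Star⁻₂ G c k → Fin (n G) → Bool
    blocked P x = used P x ∨ (heavy x ∨ does (c ≟ x))

    count-blocked : ∀ {k} (P : Star⁻₂ G c k) → count (blocked P) ≤ (k + k) + (h + 1)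
    count-blocked P =
      ≤-trans (count-∨ (used P) _)
        (+-mono-≤ (count-used P)
                  (≤-trans (count-∨ heavy (λ x → does (c ≟ x))) (+-monoʳ-≤ h (≤-reflexive (count-≟ c)))))

    unblocked⇒ : ∀ {k x} (P : Star⁻₂ G c k) → blocked P x ≡ false →
                 used P x ≡ false × heavy x ≡ false × x ≢ c
    unblocked⇒ {x = x} P unblocked =
      ∨-conicalˡ (used P x) _ unblocked ,
      ∨-conicalˡ (heavy x) _ rest ,
      does≡false⇒¬ (c ≟ x) (∨-conicalʳ (heavy x) _ rest) ∘ sym
      where
      rest : heavy x ∨ does (c ≟ x) ≡ false
      rest = ∨-conicalʳ (used P x) _ unblocked

    Extension : ∀ {k} → Star⁻₂ G c k → Fin (n G) → Fin (n G) → Set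
    Extension P x a = Edge G x a × Edge G a c × heavy a ≡ false × used P a ≡ false × blocked P x ≡ false

    extension? : ∀ {k} (P : Star⁻₂ G c k) x a → Dec (Extension P x a)
    extension? P x a = adj G x a Bool.≟ true ×-dec adj G a c Bool.≟ true ×-dec heavy a Bool.≟ false
                       ×-dec used P a Bool.≟ false ×-dec blocked P x Bool.≟ false

    Maximal : ∀ {k} → Star⁻₂ G c k → Set
    Maximal P = ∀ x a → ¬ Extension P x a

    extendLight : ∀ {k x a} (P : Star⁻₂ G c k) → Extension P x a → Star⁻₂ G c (suc k)
    extendLight P (x→a , a→c , _ , a-unused , x-unblocked) =
      let x-unused , _ , x≢c = unblocked⇒ P x-unblocked in extend P x→a a→c x-unused a-unused x≢c

    extendLight-avoids : ∀ {k x a} (P : Star⁻₂ G c k) (ext : Extension P x a) →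
                         AvoidsHeavy P → AvoidsHeavy (extendLight P ext)
    extendLight-avoids P (x→a , a→c , a-light , a-unused , x-unblocked) avoids v v-heavy =
      let x-unused , x-light , x≢c = unblocked⇒ P x-unblocked in
      used-extend P x→a a→c x-unused a-unused x≢c
        (avoids v v-heavy) (light≢heavy a-light v-heavy) (light≢heavy x-light v-heavy)

    blockedIn : ∀ {k} → Star⁻₂ G c k → Fin (n G) → ℕ
    blockedIn P a = ∑[ x < n G ] (⟦ adj G x a ⟧ * ⟦ blocked P x ⟧)

    maximal⇒indeg≤blockedIn : ∀ {k a} (P : Star⁻₂ G c k) → Maximal P →
                              Edge G a c → heavy a ≡ false → used P a ≡ false → indeg a ≤ blockedIn P a
    maximal⇒indeg≤blockedIn {a = a} P maximal a→c a-light a-unused = sum-mono-≤ in-edge≤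
      where
      in-edge≤ : ∀ x → ⟦ adj G x a ⟧ ≤ ⟦ adj G x a ⟧ * ⟦ blocked P x ⟧
      in-edge≤ x with adj G x a in x→a
      ... | false = z≤n
      ... | true rewrite ¬-not (λ unblocked → maximal x a (x→a , a→c , a-light , a-unused , unblocked))
        = ≤-refl

    weight≤ : ∀ {k a} (P : Star⁻₂ G c k) → Maximal P → Edge G a c →
              weight a ≤ d * ⟦ heavy a ⟧ + ((m + ℓ) * ⟦ used P a ⟧ + blockedIn P a)
    weight≤ {a = a} P maximal a→c with heavy a in a-heavy | used P a in a-used
    ... | true  | _     = m≤n⇒m≤n+o _ (≤-trans (m⊓n≤n _ d) (m≤m*n d 1))
    ... | false | true  = m≤n⇒m≤o+n (d * 0) (m≤n⇒m≤n+o _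
                            (≤-trans (m⊓n≤m _ d) (≤-trans (light-indeg a→c a-heavy) (m≤m*n (m + ℓ) 1))))
    ... | false | false = m≤n⇒m≤o+n (d * 0) (m≤n⇒m≤o+n ((m + ℓ) * 0)
                            (≤-trans (m⊓n≤m _ d) (maximal⇒indeg≤blockedIn P maximal a→c a-heavy a-used)))

    maximal⇒load<d² : ∀ {k} (P : Star⁻₂ G c k) → Maximal P → k + h ≤ m → load c < d * d
    maximal⇒load<d² {k} P maximal k+h≤m = begin-strict
      load c
        ≤⟨ sum-mono-≤ (λ a → ⟦⟧*≤ (adj G a c) (weight≤ P maximal)) ⟩
      ∑[ a < n G ] (d * ⟦ heavy a ⟧ + ((m + ℓ) * ⟦ used P a ⟧ + blockedIn P a))
        ≡⟨ ∑-bound ⟩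
      d * h + ((m + ℓ) * count (used P) + d * count (blocked P))
        ≤⟨ +-monoʳ-≤ (d * h) (+-mono-≤ (*-monoʳ-≤ (m + ℓ) (count-used P)) (*-monoʳ-≤ d (count-blocked P))) ⟩
      d * h + ((m + ℓ) * (k + k) + d * ((k + k) + (h + 1)))
        <⟨ stuck-load-bound k+h≤m d-large ⟩
      d * d
        ∎
      where
      open ≤-Reasoning
      ∑-blockedIn : ∑[ a < n G ] blockedIn P a ≡ d * count (blocked P)
      ∑-blockedIn = trans (∑-in-edges (⟦_⟧ ∘ blocked P)) (sym (*-distribˡ-sum d (⟦_⟧ ∘ blocked P)))
      ∑-bound : ∑[ a < n G ] (d * ⟦ heavy a ⟧ + ((m + ℓ) * ⟦ used P a ⟧ + blockedIn P a))
                ≡ d * h + ((m + ℓ) * count (used P) + d * count (blocked P))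
      ∑-bound =
        trans (∑-distrib-+ (λ a → d * ⟦ heavy a ⟧) (λ a → (m + ℓ) * ⟦ used P a ⟧ + blockedIn P a))
          (cong₂ _+_ (sym (*-distribˡ-sum d (⟦_⟧ ∘ heavy)))
            (trans (∑-distrib-+ (λ a → (m + ℓ) * ⟦ used P a ⟧) (blockedIn P))
              (cong₂ _+_ (sym (*-distribˡ-sum (m + ℓ) (⟦_⟧ ∘ used P))) ∑-blockedIn)))

    forbidden : ∀ {k r} → Star⁻₂ G c k → (Fin r → Fin (n G)) → Fin (n G) → Bool
    forbidden P R x = used P x ∨ (does (c ≟ x) ∨ image? R x)

    allowed⇒ : ∀ {k r x} (P : Star⁻₂ G c k) (R : Fin r → Fin (n G)) → forbidden P R x ≡ false →
               used P x ≡ false × x ≢ c × (∀ j → R j ≢ x)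
    allowed⇒ {x = x} P R allowed =
      ∨-conicalˡ (used P x) _ allowed ,
      does≡false⇒¬ (c ≟ x) (∨-conicalˡ (does (c ≟ x)) _ rest) ∘ sym ,
      image?-false⁻ (∨-conicalʳ (does (c ≟ x)) _ rest)
      where
      rest : does (c ≟ x) ∨ image? R x ≡ false
      rest = ∨-conicalʳ (used P x) _ allowed

    allowedLeaf : ∀ {k r} (P : Star⁻₂ G c k) (R : Fin (suc r) → Fin (n G)) → k + suc r ≡ ℓ →
                  heavy (R zero) ≡ true → ∃ λ x → Edge G x (R zero) × forbidden P (R ∘ suc) x ≡ false
    allowedLeaf {k} {r} P R k+r≡ℓ a-heavy =
      count-pigeonhole (λ x → adj G x (R zero)) (forbidden P (R ∘ suc)) (begin-strict
        count (forbidden P (R ∘ suc))  ≤⟨ count-forbidden ⟩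
        (k + k) + (1 + r)              ≡⟨ regroup k r ⟩
        k + (k + suc r)                <⟨ +-monoˡ-< (k + suc r) (m<m+n k (s≤s z≤n)) ⟩
        (k + suc r) + (k + suc r)      ≡⟨ cong₂ _+_ k+r≡ℓ k+r≡ℓ ⟩
        ℓ + ℓ                          ≤⟨ proj₂ (heavy⇒ a-heavy) ⟩
        indeg (R zero)                 ∎)
      where
      open ≤-Reasoning
      count-forbidden : count (forbidden P (R ∘ suc)) ≤ (k + k) + (1 + r)
      count-forbidden = ≤-trans (count-∨ (used P) _) (+-mono-≤ (count-used P)
                          (≤-trans (count-∨ (λ x → does (c ≟ x)) (image? (R ∘ suc)))
                                   (+-mono-≤ (≤-reflexive (count-≟ c)) (count-image? (R ∘ suc)))))
      regroup : ∀ k r → (k + k) + (1 + r) ≡ k + (k + suc r)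
      regroup = solve-∀

    completeWithReserved : ∀ r {k} → k + r ≡ ℓ → (P : Star⁻₂ G c k) (R : Fin r → Fin (n G)) →
                           Injective _≡_ _≡_ R → (∀ j → heavy (R j) ≡ true) →
                           (∀ j → used P (R j) ≡ false) → Star⁻₂ G c ℓ
    completeWithReserved zero {k} k+0≡ℓ P _ _ _ _ =
      subst (Star⁻₂ G c) (trans (sym (+-identityʳ k)) k+0≡ℓ) P
    completeWithReserved (suc r) {k} k+r≡ℓ P R R-inj R-heavy R-unused
      with allowedLeaf P R k+r≡ℓ (R-heavy zero)
    ... | x , x→a , x-allowed =
      completeWithReserved r (trans (sym (+-suc k r)) k+r≡ℓ) P′
        (R ∘ suc) (suc-injective ∘ R-inj) (R-heavy ∘ suc)
        (λ j → used-extend P x→a a→c x-unused (R-unused zero) x≢c (R-unused (suc j))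
                 (0≢1+n ∘ R-inj) (x∉R j ∘ sym))
      where
      a→c : Edge G (R zero) c
      a→c = proj₁ (heavy⇒ (R-heavy zero))
      x-unused : used P x ≡ false
      x-unused = proj₁ (allowed⇒ P (R ∘ suc) x-allowed)
      x≢c : x ≢ c
      x≢c = proj₁ (proj₂ (allowed⇒ P (R ∘ suc) x-allowed))
      x∉R : ∀ j → R (suc j) ≢ x
      x∉R = proj₂ (proj₂ (allowed⇒ P (R ∘ suc) x-allowed))
      P′ : Star⁻₂ G c (suc k)
      P′ = extend P x→a a→c x-unused (R-unused zero) x≢c

    completeWithHeavy : ∀ {k} (P : Star⁻₂ G c k) → AvoidsHeavy P → k ≤ ℓ → ℓ ≤ k + h → Star⁻₂ G c ℓ
    completeWithHeavy {k} P avoids k≤ℓ ℓ≤k+h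
      with select heavy (ℓ ∸ k) (≤-trans (∸-monoˡ-≤ k ℓ≤k+h) (≤-reflexive (m+n∸m≡n k h)))
    ... | R , R-inj , R-heavy =
      completeWithReserved (ℓ ∸ k) (m+[n∸m]≡n k≤ℓ) P R R-inj R-heavy (λ j → avoids (R j) (R-heavy j))

    grow : ∀ gap {k} → k ≤ ℓ → ℓ ≤ gap + (k + h) → (P : Star⁻₂ G c k) → AvoidsHeavy P →
           load c < d * d ⊎ Star⁻₂ G c ℓ
    grow gap {k} k≤ℓ ℓ≤gap+k+h P avoids with ℓ ≤? k + h
    ... | yes ℓ≤k+h = inj₂ (completeWithHeavy P avoids k≤ℓ ℓ≤k+h)
    grow zero k≤ℓ ℓ≤k+h P avoids | no ℓ≰k+h = contradiction ℓ≤k+h ℓ≰k+h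
    grow (suc gap) {k} k≤ℓ ℓ≤gap+k+h P avoids | no ℓ≰k+h with any? (λ x → any? (extension? P x))
    ... | yes (x , a , ext) =
      grow gap (≤-trans (s≤s (m≤m+n k h)) (≰⇒> ℓ≰k+h))
        (subst (ℓ ≤_) (sym (+-suc gap (k + h))) ℓ≤gap+k+h)
        (extendLight P ext) (extendLight-avoids P ext avoids)
    ... | no ∄ext = inj₁ (maximal⇒load<d² P (λ x a ext → ∄ext (x , a , ext)) (≤-pred (≰⇒> ℓ≰k+h)))

    star : d * d ≤ load c → Star⁻₂ G c ℓ
    star d²≤load with grow ℓ z≤n (m≤m+n ℓ h) emptyStar (λ _ _ → refl)
    ... | inj₁ load<d² = contradiction d²≤load (<⇒≱ load<d²)
    ... | inj₂ S       = S

  containsS⁻₂ : ∀ m → 2 * suc m * d + 4 * (suc m * suc m) ≤ d * d → Fin (n G) → ContainsS⁻₂ G (suc m)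
  containsS⁻₂ m d-large v =
    let c , d²≤load = ∃-load≥d² v in Star⁻₂⇒ContainsS⁻₂ (Greedy.star m d-large c d²≤load)

theorem1p8 : (ℓ : ℕ) → 1 ≤ ℓ → (G : Digraph) →
    MinOutdegAtLeast1+√5Times G ℓ → ContainsS⁻₂ G ℓ
theorem1p8 (suc m) _ G (0<n , large) =
  ContainsS⁻₂-prune G d
    (OutRegular.containsS⁻₂ (prune G d) d regular m (d≥[1+√5]ℓ⇒2ℓd+4ℓ²≤d² (large u₀)) v)
  where
  v : Fin (n G)
  v = fromℕ< 0<n
  u₀ : Fin (n G)
  u₀ = minOutdegVertex G v
  d : ℕ
  d = outdeg G u₀
  regular : ∀ u → outdeg (prune G d) u ≡ d
  regular u = outdeg-prune G u (minOutdegVertex-≤ G v u)
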